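{- Every pseudo-descending sequence is eventually zero: for every $f : \mathbb{N} \to \mathrm{MutualOrd}$, if $f$ is pseudo-descending then $f$ is eventually zero.
   Context: Work in cubical type theory (as implemented in cubical Agda); $x \equiv y$ denotes the path type, $A \uplus B$ the coproduct, $\times$ the product, $\Sigma$ dependent sums. $\mathrm{MutualOrd} : \mathrm{Type}_0$ is defined simultaneously (inductive-inductive-recursively) with a relation $<$ on it and a function $\mathrm{fst} : \mathrm{MutualOrd} \to \mathrm{MutualOrd}$: its constructors are $\mathbf{0}$ and, for $a, b : \mathrm{MutualOrd}$ and $r : a \geq \mathrm{fst}(b)$, an element $\omega^a + b\,[r]$, where $a \geq b := (b < a) \uplus (a \equiv b)$. The relation $<$ is generated by: $\mathbf{0} < \omega^a + b\,[r]$; if $a < c$ then $\omega^a + b\,[r] < \omega^c + d\,[s]$; if $a \equiv c$ and $b < d$ then $\omega^a + b\,[r] < \omega^c + d\,[s]$. Finally $\mathrm{fst}(\mathbf{0}) = \mathbf{0}$ and $\mathrm{fst}(\omega^a + b\,[r]) = a$. Write $a > b$ for $b < a$. A sequence $f : \mathbb{N} \to \mathrm{MutualOrd}$ is pseudo-descending if for every $i : \mathbb{N}$, $\big(f(i) > f(i+1)\big) \uplus \big(f(i) \equiv \mathbf{0} \times f(i+1) \equiv \mathbf{0}\big)$. It is eventually zero if there is (as a $\Sigma$-type) an $n : \mathbb{N}$ such that for all $i \geq n$ (the standard order on $\mathbb{N}$), $f(i) \equiv \mathbf{0}$. -}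

module Defs where

open import Data.Nat using (ℕ; suc) renaming (_≥_ to _≥ℕ_)
open import Data.Sum using (_⊎_)
open import Data.Product using (Σ; _×_)
open import Relation.Binary.PropositionalEquality using (_≡_)

-- Ordinals below ε₀ in Cantor normal form, defined
-- inductive-inductive-recursively together with _<_ and fst.
data MutualOrd : Set
data _<_ : MutualOrd → MutualOrd → Set
fst : MutualOrd → MutualOrd

_≥_ : MutualOrd → MutualOrd → Set
a ≥ b = (b < a) ⊎ (a ≡ b)

infix 30 _<_ _≥_ _>_

data MutualOrd where
  𝟎 : MutualOrd
  ω^_+_[_] : (a b : MutualOrd) → a ≥ fst b → MutualOrd

data _<_ where
  <₁ : ∀ {a b r} → 𝟎 < ω^ a + b [ r ]
  <₂ : ∀ {a b c d r s} → a < c → ω^ a + b [ r ] < ω^ c + d [ s ]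
  <₃ : ∀ {a b c d r s} → a ≡ c → b < d → ω^ a + b [ r ] < ω^ c + d [ s ]

fst 𝟎 = 𝟎
fst (ω^ a + _ [ _ ]) = a

_>_ : MutualOrd → MutualOrd → Set
a > b = b < a

PseudoDescending : (ℕ → MutualOrd) → Set
PseudoDescending f = (i : ℕ) → (f i > f (suc i)) ⊎ ((f i ≡ 𝟎) × (f (suc i) ≡ 𝟎))

EventuallyZero : (ℕ → MutualOrd) → Set
EventuallyZero f = Σ ℕ (λ n → (i : ℕ) → i ≥ℕ n → f i ≡ 𝟎)

module Submission where

-- The argument is well-founded induction on the first term of the sequence.
--  * The order _<_ on MutualOrd is well founded.  This is the usual
--    lexicographic argument on Cantor normal forms: ω^ a + b [ r ] is
--    accessible as soon as a and b are, and the tail b is accessible because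
--    its leading exponent fst b is at most a (this is where the side
--    condition r is used).
--  * Since nothing lies below 𝟎, a pseudo-descending sequence that reaches 𝟎
--    stays there forever, so it is eventually zero.
--  * Otherwise its first step is a strict descent f 1 < f 0; the shifted
--    sequence is again pseudo-descending and starts lower, hence is
--    eventually zero by the induction hypothesis, and so is f.

open import Defs
open import Data.Nat using (ℕ; zero; suc; _≤′_; ≤′-refl; ≤′-step; s≤s)
open import Data.Nat.Properties using (≤⇒≤′)
open import Data.Sum using (inj₁; inj₂)
open import Data.Product using (_,_)
open import Induction.WellFounded using (Acc; acc; WellFounded)
open import Relation.Nullary using (¬_; contradiction)
open import Relation.Binary.PropositionalEquality using (_≡_; refl; subst)

nothing<𝟎 : ∀ {x} → ¬ (x < 𝟎)
nothing<𝟎 ()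

𝟎-accessible : Acc _<_ 𝟎
𝟎-accessible = acc (λ y<𝟎 → contradiction y<𝟎 nothing<𝟎)

mutual
  tail-accessible : ∀ {a} → Acc _<_ a → ∀ b → a ≥ fst b → Acc _<_ b
  tail-accessible _ 𝟎 _ = 𝟎-accessible
  tail-accessible (acc below-a) (ω^ c + d [ s ]) (inj₁ c<a) =
    ω-accessible (below-a c<a) (tail-accessible (below-a c<a) d s) s
  tail-accessible acc-a (ω^ c + d [ s ]) (inj₂ refl) =
    ω-accessible acc-a (tail-accessible acc-a d s) s

  ω-accessible : ∀ {a b} → Acc _<_ a → Acc _<_ b → ∀ r → Acc _<_ (ω^ a + b [ r ])
  ω-accessible acc-a acc-b r = acc (below acc-a acc-b r)
    where
    below : ∀ {a b} → Acc _<_ a → Acc _<_ b → ∀ r →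
            ∀ {y} → y < ω^ a + b [ r ] → Acc _<_ y
    below _ _ _ <₁ = 𝟎-accessible
    below (acc below-a) _ _ (<₂ {b = d} {r = s} c<a) =
      ω-accessible (below-a c<a) (tail-accessible (below-a c<a) d s) s
    below acc-a (acc below-b) _ (<₃ {b = d} {r = s} refl d<b) =
      ω-accessible acc-a (below-b d<b) s

<-wellFounded : WellFounded _<_
<-wellFounded 𝟎 = 𝟎-accessible
<-wellFounded (ω^ a + b [ r ]) =
  ω-accessible (<-wellFounded a) (tail-accessible (<-wellFounded a) b r) r

stays-zero : ∀ {f n} → PseudoDescending f → f n ≡ 𝟎 → ∀ {i} → n ≤′ i → f i ≡ 𝟎
stays-zero _ fn≡𝟎 ≤′-refl = fn≡𝟎
stays-zero {f} pd fn≡𝟎 (≤′-step {i} n≤i) with pd i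
... | inj₁ next<fi = contradiction (subst (f (suc i) <_) (stays-zero pd fn≡𝟎 n≤i) next<fi) nothing<𝟎
... | inj₂ (_ , next≡𝟎) = next≡𝟎

unshift : ∀ {f} → EventuallyZero (λ i → f (suc i)) → EventuallyZero f
unshift (n , zero-after-n) = suc n , λ { zero () ; (suc i) (s≤s n≤i) → zero-after-n i n≤i }

eventually-zero : ∀ {f} → Acc _<_ (f 0) → PseudoDescending f → EventuallyZero f
eventually-zero {f} (acc below-f0) pd with pd 0
... | inj₂ (f0≡𝟎 , _) = 0 , λ i 0≤i → stays-zero pd f0≡𝟎 (≤⇒≤′ 0≤i)
... | inj₁ f1<f0 = unshift (eventually-zero (below-f0 f1<f0) (λ i → pd (suc i)))

theorem5p3 : (f : ℕ → MutualOrd) → PseudoDescending f → EventuallyZero f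
theorem5p3 f = eventually-zero (<-wellFounded (f 0))
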